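{- Let $G$ be a graph and let $S$ and $S'$ be complete plays of the edge domination game on $G$, both 2-1 plays. If $|V(G)\setminus C_S|\leq1$ and $|V(G)\setminus C_{S'}|\leq 1$, then $|S|=|S'|$.
   Context: For an edge $e$ of a graph $G$, $N[e]$ denotes $e$ together with all edges sharing an endpoint with $e$. In the edge domination game on $G$, Dominator and Staller alternately choose edges, Dominator first (odd-numbered moves Dominator); each chosen edge $s_i$ must satisfy $N[s_i]\setminus\bigcup_{j<i}N[s_j]\neq\emptyset$; the game ends when all edges lie in $\bigcup_jN[s_j]$. For a play $S=s_1\dots s_{|S|}$, $C_{S,i}$ is the set of endpoints of $s_1,\dots,s_i$ ($C_{S,0}=\emptyset$) and $C_S=C_{S,|S|}$. $S$ is a 2-1 play if $|C_{S,i}\setminus C_{S,i-1}|=2$ for every odd $i$ and $|C_{S,i}\setminus C_{S,i-1}|=1$ for every even $i$. -}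

module Defs where

open import Data.Nat using (ℕ; suc; _%_)
open import Data.Fin using (Fin; toℕ)
open import Data.Fin.Subset using (Subset; ⊥; ⁅_⁆; _∪_; _─_; ∣_∣; ∁)
open import Data.List using (List; []; _∷_; length; lookup; take)
open import Data.List.Relation.Unary.Any using (Any)
open import Data.Product using (Σ; _×_; _,_; proj₁; proj₂; ∃)
open import Data.Sum using (_⊎_)
open import Relation.Nullary using (¬_)
open import Relation.Binary.PropositionalEquality using (_≡_)

record Graph (n : ℕ) : Set₁ where
  field
    Adj    : Fin n → Fin n → Set
    sym    : ∀ {u v} → Adj u v → Adj v u
    irrefl : ∀ {u} → ¬ Adj u u
open Graph public

module _ {n : ℕ} (G : Graph n) where

  -- An edge uv of G (given with an orientation; uv and vu denote the same edge).
  Edge : Set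
  Edge = Σ (Fin n × Fin n) λ p → Adj G (proj₁ p) (proj₂ p)

  u₀ v₀ : Edge → Fin n
  u₀ e = proj₁ (proj₁ e)
  v₀ e = proj₂ (proj₁ e)

  IsEndpoint : Fin n → Edge → Set
  IsEndpoint w e = w ≡ u₀ e ⊎ w ≡ v₀ e

  _∈N[_] : Edge → Edge → Set
  f ∈N[ e ] = ∃ λ w → IsEndpoint w e × IsEndpoint w f

  InUnionN : List Edge → Edge → Set
  InUnionN ss f = Any (λ s → f ∈N[ s ]) ss

  LegalMove : List Edge → Edge → Set
  LegalMove ss s = ∃ λ f → f ∈N[ s ] × ¬ InUnionN ss f

  -- S = s_1 … s_k is a play: every move s_i is legal w.r.t. s_1 … s_{i-1}
  -- (index i : Fin (length S) is 0-based, so move i is s_{i+1}).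
  IsPlay : List Edge → Set
  IsPlay S = (i : Fin (length S)) → LegalMove (take (toℕ i) S) (lookup S i)

  AllDominated : List Edge → Set
  AllDominated S = (f : Edge) → InUnionN S f

  IsCompletePlay : List Edge → Set
  IsCompletePlay S = IsPlay S × AllDominated S

  ends : Edge → Subset n
  ends e = ⁅ u₀ e ⁆ ∪ ⁅ v₀ e ⁆

  C : List Edge → Subset n
  C []       = ⊥
  C (s ∷ ss) = ends s ∪ C ss

  -- C_{S,i} for 1 ≤ i ≤ |S| is C (take i S); for the move with 0-based index i
  -- the newly covered vertices are C_{S,i+1} ∖ C_{S,i}.
  newVertices : (S : List Edge) → Fin (length S) → ℕ
  newVertices S i = ∣ C (take (suc (toℕ i)) S) ─ C (take (toℕ i) S) ∣

  -- 2-1 play: odd (1-based) moves cover 2 new vertices, even ones cover 1.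
  -- 1-based index i+1 is odd iff 0-based index i is even.
  Is21Play : List Edge → Set
  Is21Play S = (i : Fin (length S)) →
    (toℕ i % 2 ≡ 0 → newVertices S i ≡ 2) × (toℕ i % 2 ≡ 1 → newVertices S i ≡ 1)

  uncovered : List Edge → ℕ
  uncovered S = ∣ ∁ (C S) ∣

-- In a 2-1 play the number of covered vertices after i moves is forced: it is
-- c i = 0, 2, 3, 5, 6, … independently of the play. A legal move needs an edge
-- with both endpoints still uncovered, so any 2-1 play that makes move i + 1 has
-- c i ≤ n − 2, whereas a 2-1 play ending after i moves with at most one vertex
-- uncovered has c i ≥ n − 1. Hence neither of two such complete plays can be
-- longer than the other.
module Submission where

open import Data.Nat using (ℕ; zero; suc; _+_; _∸_; _≤_; _<_; s≤s)
open import Data.Nat.Properties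
  using (+-suc; +-comm; +-monoʳ-≤; m≤n+m∸n; ≤-trans; ≤-reflexive; ≤-refl; ≤-antisym; <⇒≤; <⇒≱; ≮⇒≥)
open import Data.Nat.DivMod using (_%_; m%n<n)
open import Data.Fin using (toℕ; fromℕ<)
open import Data.Fin.Properties using (toℕ-fromℕ<)
open import Data.Fin.Subset using (Subset; inside; outside; _∈_; _∉_; _⊆_; _∪_; _─_; ⁅_⁆; ∣_∣; ∁)
open import Data.Fin.Subset.Properties
  using (drop-∷-⊆; ∉⊥; ∣⊥∣≡0; ∣p∣≤n; ∣∁p∣≡n∸∣p∣; p⊂q⇒∣p∣<∣q∣; p⊆p∪q; x∈p∪q⁺; x∈p∪q⁻; x∈⁅x⁆; x∈⁅y⁆⇒x≡y)
open import Data.Vec using (_∷_; []; here)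
open import Data.List using (List; []; _∷_; length; take; lookup)
open import Data.List.Properties using (take-all)
open import Data.List.Relation.Unary.Any using (here; there)
open import Data.Product using (_,_; proj₁; proj₂)
open import Data.Sum using (inj₁; inj₂)
open import Data.Empty using (⊥-elim)
open import Relation.Nullary using (¬_)
open import Relation.Binary.PropositionalEquality using (_≡_; refl; sym; trans; cong; cong₂; subst; module ≡-Reasoning)
open import Defs hiding (sym)

∣p∣≡∣q∣+∣p─q∣ : ∀ {n} (p q : Subset n) → q ⊆ p → ∣ p ∣ ≡ ∣ q ∣ + ∣ p ─ q ∣
∣p∣≡∣q∣+∣p─q∣ []            []            _   = refl
∣p∣≡∣q∣+∣p─q∣ (inside  ∷ p) (inside  ∷ q) q⊆p = cong suc (∣p∣≡∣q∣+∣p─q∣ p q (drop-∷-⊆ q⊆p))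
∣p∣≡∣q∣+∣p─q∣ (inside  ∷ p) (outside ∷ q) q⊆p =
  trans (cong suc (∣p∣≡∣q∣+∣p─q∣ p q (drop-∷-⊆ q⊆p))) (sym (+-suc ∣ q ∣ ∣ p ─ q ∣))
∣p∣≡∣q∣+∣p─q∣ (outside ∷ p) (inside  ∷ q) q⊆p with q⊆p here
... | ()
∣p∣≡∣q∣+∣p─q∣ (outside ∷ p) (outside ∷ q) q⊆p = ∣p∣≡∣q∣+∣p─q∣ p q (drop-∷-⊆ q⊆p)

x∉p⇒∣p∣<∣p∪⁅x⁆∣ : ∀ {n} {p : Subset n} {x} → x ∉ p → ∣ p ∣ < ∣ p ∪ ⁅ x ⁆ ∣
x∉p⇒∣p∣<∣p∪⁅x⁆∣ {x = x} x∉p = p⊂q⇒∣p∣<∣q∣ (p⊆p∪q ⁅ x ⁆ , x , x∈p∪q⁺ (inj₂ (x∈⁅x⁆ x)) , x∉p)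

x∉p∧y∉p∧x≢y⇒2+∣p∣≤n : ∀ {n} {p : Subset n} {x y} → x ∉ p → y ∉ p → ¬ x ≡ y → 2 + ∣ p ∣ ≤ n
x∉p∧y∉p∧x≢y⇒2+∣p∣≤n {n} {p} {x} {y} x∉p y∉p x≢y =
  ≤-trans (s≤s (x∉p⇒∣p∣<∣p∪⁅x⁆∣ x∉p)) (≤-trans (x∉p⇒∣p∣<∣p∪⁅x⁆∣ y∉p∪⁅x⁆) (∣p∣≤n ((p ∪ ⁅ x ⁆) ∪ ⁅ y ⁆)))
  where
  y∉p∪⁅x⁆ : y ∉ p ∪ ⁅ x ⁆
  y∉p∪⁅x⁆ y∈ with x∈p∪q⁻ p ⁅ x ⁆ y∈
  ... | inj₁ y∈p  = y∉p y∈p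
  ... | inj₂ y∈⁅x⁆ = x≢y (sym (x∈⁅y⁆⇒x≡y x y∈⁅x⁆))

∣∁p∣≤1⇒n≤∣p∣+1 : ∀ {n} (p : Subset n) → ∣ ∁ p ∣ ≤ 1 → n ≤ ∣ p ∣ + 1
∣∁p∣≤1⇒n≤∣p∣+1 {n} p ∣∁p∣≤1 =
  ≤-trans (m≤n+m∸n n ∣ p ∣) (+-monoʳ-≤ ∣ p ∣ (subst (_≤ 1) (∣∁p∣≡n∸∣p∣ p) ∣∁p∣≤1))

coveredCount : ℕ → ℕ
coveredCount zero    = 0
coveredCount (suc i) = coveredCount i + (2 ∸ i % 2)

module _ {n : ℕ} (G : Graph n) where

  endpoint∈C⇒InUnionN : ∀ ss f {w} → IsEndpoint G w f → w ∈ C G ss → InUnionN G ss f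
  endpoint∈C⇒InUnionN []       f w∈f w∈C = ⊥-elim (∉⊥ w∈C)
  endpoint∈C⇒InUnionN (s ∷ ss) f {w} w∈f w∈C with x∈p∪q⁻ (ends G s) (C G ss) w∈C
  ... | inj₂ w∈Css = there (endpoint∈C⇒InUnionN ss f w∈f w∈Css)
  ... | inj₁ w∈s with x∈p∪q⁻ ⁅ u₀ G s ⁆ ⁅ v₀ G s ⁆ w∈s
  ...   | inj₁ w∈u = here (w , inj₁ (x∈⁅y⁆⇒x≡y _ w∈u) , w∈f)
  ...   | inj₂ w∈v = here (w , inj₂ (x∈⁅y⁆⇒x≡y _ w∈v) , w∈f)

  -- The undominated edge in N[s] has two distinct endpoints, both outside C ss.
  LegalMove⇒2+∣C∣≤n : ∀ ss s → LegalMove G ss s → 2 + ∣ C G ss ∣ ≤ n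
  LegalMove⇒2+∣C∣≤n ss s (f , _ , f∉N) =
    x∉p∧y∉p∧x≢y⇒2+∣p∣≤n
      (λ u∈C → f∉N (endpoint∈C⇒InUnionN ss f (inj₁ refl) u∈C))
      (λ v∈C → f∉N (endpoint∈C⇒InUnionN ss f (inj₂ refl) v∈C))
      (λ u≡v → irrefl G (subst (λ z → Adj G z (v₀ G f)) u≡v (proj₂ f)))

  C-take-⊆ : ∀ i S → C G (take i S) ⊆ C G (take (suc i) S)
  C-take-⊆ zero    []      x∈ = x∈
  C-take-⊆ (suc i) []      x∈ = x∈
  C-take-⊆ zero    (s ∷ S) x∈ = ⊥-elim (∉⊥ x∈)
  C-take-⊆ (suc i) (s ∷ S) x∈ with x∈p∪q⁻ (ends G s) (C G (take i S)) x∈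
  ... | inj₁ x∈s = x∈p∪q⁺ (inj₁ x∈s)
  ... | inj₂ x∈C = x∈p∪q⁺ (inj₂ (C-take-⊆ i S x∈C))

  Is21Play⇒newVertices : ∀ S → Is21Play G S → ∀ i → newVertices G S i ≡ 2 ∸ toℕ i % 2
  Is21Play⇒newVertices S h i with toℕ i % 2 in eq | m%n<n (toℕ i) 2
  ... | 0 | _ = proj₁ (h i) eq
  ... | 1 | _ = proj₂ (h i) eq
  ... | suc (suc _) | s≤s (s≤s ())

  Is21Play⇒∣C-take∣ : ∀ S → Is21Play G S → ∀ i → i ≤ length S → ∣ C G (take i S) ∣ ≡ coveredCount i
  Is21Play⇒∣C-take∣ S h zero    _ = ∣⊥∣≡0 n
  Is21Play⇒∣C-take∣ S h (suc i) i<∣S∣ = begin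
    ∣ C G (take (suc i) S) ∣
      ≡⟨ ∣p∣≡∣q∣+∣p─q∣ (C G (take (suc i) S)) (C G (take i S)) (C-take-⊆ i S) ⟩
    ∣ C G (take i S) ∣ + ∣ C G (take (suc i) S) ─ C G (take i S) ∣
      ≡⟨ cong₂ _+_ (Is21Play⇒∣C-take∣ S h i (<⇒≤ i<∣S∣)) new ⟩
    coveredCount i + (2 ∸ i % 2) ∎
    where
    open ≡-Reasoning
    new : ∣ C G (take (suc i) S) ─ C G (take i S) ∣ ≡ 2 ∸ i % 2
    new = subst (λ j → ∣ C G (take (suc j) S) ─ C G (take j S) ∣ ≡ 2 ∸ j % 2)
                (toℕ-fromℕ< i<∣S∣) (Is21Play⇒newVertices S h (fromℕ< i<∣S∣))

  move⇒2+coveredCount≤n : ∀ S → IsPlay G S → Is21Play G S → ∀ i → i < length S → 2 + coveredCount i ≤ n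
  move⇒2+coveredCount≤n S play h i i<∣S∣ =
    subst (λ c → 2 + c ≤ n) (Is21Play⇒∣C-take∣ S h i (<⇒≤ i<∣S∣))
      (subst (λ j → 2 + ∣ C G (take j S) ∣ ≤ n) (toℕ-fromℕ< i<∣S∣)
        (LegalMove⇒2+∣C∣≤n _ (lookup S (fromℕ< i<∣S∣)) (play (fromℕ< i<∣S∣))))

  uncovered≤1⇒n≤coveredCount+1 : ∀ S → Is21Play G S → uncovered G S ≤ 1 → n ≤ coveredCount (length S) + 1
  uncovered≤1⇒n≤coveredCount+1 S h u≤1 = subst (λ c → n ≤ c + 1) ∣C∣≡ (∣∁p∣≤1⇒n≤∣p∣+1 (C G S) u≤1)
    where
    ∣C∣≡ : ∣ C G S ∣ ≡ coveredCount (length S)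
    ∣C∣≡ = trans (cong (λ T → ∣ C G T ∣) (sym (take-all (length S) S ≤-refl)))
                 (Is21Play⇒∣C-take∣ S h (length S) ≤-refl)

  length-≤-of-nearly-covering : ∀ S S′ → IsPlay G S′ → Is21Play G S′ → Is21Play G S →
    uncovered G S ≤ 1 → length S′ ≤ length S
  length-≤-of-nearly-covering S S′ play′ h′ h u≤1 = ≮⇒≥ λ ∣S∣<∣S′∣ →
    <⇒≱ (≤-trans (s≤s (≤-reflexive (+-comm (coveredCount (length S)) 1)))
                 (move⇒2+coveredCount≤n S′ play′ h′ (length S) ∣S∣<∣S′∣))
        (uncovered≤1⇒n≤coveredCount+1 S h u≤1)

proposition7 : (n : ℕ) (G : Graph n) (S S′ : List (Edge G)) →
    IsCompletePlay G S → IsCompletePlay G S′ →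
    Is21Play G S → Is21Play G S′ →
    uncovered G S ≤ 1 → uncovered G S′ ≤ 1 →
    length S ≡ length S′
proposition7 n G S S′ (play , _) (play′ , _) h h′ u≤1 u′≤1 =
  ≤-antisym (length-≤-of-nearly-covering G S′ S play h h′ u′≤1)
            (length-≤-of-nearly-covering G S S′ play′ h′ h u≤1)
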